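{- For all integers $n,k\ge 1$, $$p^k_n=p^{k-1}_n+\sum_{s=0}^{n-1}\binom{n}{s}\,p^{k-1}_s.$$
   Context: A preferential arrangement of a finite set $S$ is an ordered set partition of $S$ (a sequence of nonempty pairwise disjoint blocks with union $S$); the empty set has exactly one. Let $a(w)$ be the number of preferential arrangements of a $w$-element set ($a(0)=1$). A barred preferential arrangement of $X_n=\{1,\dots,n\}$ with $k$ bars is a sequence of $k+1$ possibly empty, pairwise disjoint sections with union $X_n$, each equipped with a preferential arrangement of its elements. A restricted section is one whose preferential arrangement has at most one block; a free section may carry any preferential arrangement. For $k\ge0$, $p^k_n$ is the number of barred preferential arrangements of $X_n$ with $k$ bars in which one fixed section is free and the other $k$ sections are restricted; equivalently $p^k_n=\sum_{w_1+\cdots+w_{k+1}=n}\frac{n!}{w_1!\cdots w_{k+1}!}a(w_{1})$ (sum over nonnegative integer solutions). -}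

module Defs where

open import Data.Nat using (ℕ; zero; suc; _+_; _*_; _∸_; _/_; _!)
open import Data.Nat.Combinatorics using (_C_)
open import Data.Nat.Base using (NonZero)
open import Data.Nat.Properties using (_!≢0; m*n≢0)
open import Data.Nat.ListAction using (sum)
open import Data.List using (List; []; _∷_; map; concatMap; upTo)

Σ< : ℕ → (ℕ → ℕ) → ℕ
Σ< zero f = 0
Σ< (suc n) f = Σ< n f + f n

-- Ordered Bell numbers with an explicit bound b (structural recursion);
-- aB b w is correct whenever w ≤ b.
-- Recursion: choose the j-element first block (1 ≤ j ≤ w), arrange the rest:
--   a(0) = 1,  a(y+1) = Σ_{i<y+1} C(y+1, i+1) · a(y - i).
aB : ℕ → ℕ → ℕ
aB _ zero = 1
aB zero (suc _) = 0
aB (suc b) (suc y) = Σ< (suc y) (λ i → (suc y C suc i) * aB b (y ∸ i))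

a : ℕ → ℕ
a w = aB w w

compositions : ℕ → ℕ → List (List ℕ)
compositions zero zero = [] ∷ []
compositions zero (suc _) = []
compositions (suc m) n =
  concatMap (λ w → map (w ∷_) (compositions m (n ∸ w))) (upTo (suc n))

factProd : List ℕ → ℕ
factProd [] = 1
factProd (w ∷ ws) = w ! * factProd ws

factProd≢0 : ∀ ws → NonZero (factProd ws)
factProd≢0 [] = _
factProd≢0 (w ∷ ws) = m*n≢0 (w !) (factProd ws) {{w !≢0}} {{factProd≢0 ws}}

multinomial : ℕ → List ℕ → ℕ
multinomial n ws = (n !) / factProd ws
  where instance _ = factProd≢0 ws

-- term of the sum: multinomial times a(w₁) (the free section is the first)
term : ℕ → List ℕ → ℕ
term n [] = 0
term n (w ∷ ws) = multinomial n (w ∷ ws) * a w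

p : ℕ → ℕ → ℕ
p k n = sum (map (term n) (compositions (suc k) n))

{-# OPTIONS --safe #-}
-- With the binomial convolution (f ⋆ g) n = Σ_{w ≤ n} C(n,w) f(w) g(n − w), splitting off the
-- free section gives p_k = a ⋆ R_k, where R_k r = restricted k r counts the arrangements of r points in k
-- restricted sections, and splitting off one restricted section gives R_{k+1} = 1 ⋆ R_k.
-- The convolution is commutative, and left-commutative because C(n,w) C(n−w,t) = C(n,t) C(n−t,w);
-- hence p_{k+1} = a ⋆ (1 ⋆ R_k) = 1 ⋆ (a ⋆ R_k) = 1 ⋆ p_k = p_k ⋆ 1, whose term s = n is p_k n.
module Submission where

open import Defs
open import Data.Nat using (ℕ; suc; _*_)
open import Data.Nat.Combinatorics using (_C_)
open import Relation.Binary.PropositionalEquality using (_≡_)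
open import Data.Nat using (_+_)

open import Data.Nat.Base using (zero; _∸_; _!; _≤_; _<_; _≤′_; ≤′-refl; ≤′-step; s≤s; s≤s⁻¹)
open import Data.Nat.Properties
open import Data.Nat.Combinatorics using (nCk≡n!/k![n-k]!; k![n∸k]!∣n!; k>n⇒nCk≡0; nCk≡nC[n∸k]; nCn≡1)
open import Data.Nat.Divisibility using (_∣_; ∣-refl; ∣-trans; *-monoʳ-∣)
open import Data.Nat.DivMod using (m/n*n≡m)
open import Data.Nat.ListAction using (sum)
open import Data.Nat.ListAction.Properties using (sum-++)
open import Data.Nat.Solver using (module +-*-Solver)
open import Data.List using (List; []; _∷_; _++_; _∷ʳ_; map; concatMap; applyUpTo; upTo)
open import Data.List.Properties using (map-++; map-∘; map-cong-local; map-applyUpTo; applyUpTo-∷ʳ)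
open import Data.List.Relation.Unary.All as All using (All; []; _∷_)
open import Data.List.Relation.Unary.All.Properties using (concat⁺; map⁺; applyUpTo⁺₁)
open import Algebra.Properties.CommutativeSemigroup *-commutativeSemigroup using (xy∙z≈xz∙y; x∙yz≈y∙xz)
open import Function using (_∘_; id; const)
open import Relation.Nullary using (yes; no)
open import Relation.Binary.PropositionalEquality using (refl; sym; trans; cong; cong₂; subst; module ≡-Reasoning)

open +-*-Solver
open ≡-Reasoning

Σ<-cong : ∀ n {f g : ℕ → ℕ} → (∀ i → i < n → f i ≡ g i) → Σ< n f ≡ Σ< n g
Σ<-cong zero    eq = refl
Σ<-cong (suc n) eq = cong₂ _+_ (Σ<-cong n (λ i i<n → eq i (m<n⇒m<1+n i<n))) (eq n (n<1+n n))

Σ<-zero : ∀ n → Σ< n (const 0) ≡ 0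
Σ<-zero zero    = refl
Σ<-zero (suc n) = cong (_+ 0) (Σ<-zero n)

Σ<-distrib-+ : ∀ n (f g : ℕ → ℕ) → Σ< n (λ i → f i + g i) ≡ Σ< n f + Σ< n g
Σ<-distrib-+ zero    f g = refl
Σ<-distrib-+ (suc n) f g = begin
  Σ< n (λ i → f i + g i) + (f n + g n) ≡⟨ cong (_+ (f n + g n)) (Σ<-distrib-+ n f g) ⟩
  (Σ< n f + Σ< n g) + (f n + g n)      ≡⟨ +-interchange (Σ< n f) (Σ< n g) (f n) (g n) ⟩
  (Σ< n f + f n) + (Σ< n g + g n)      ∎
  where
  +-interchange : ∀ w x y z → (w + x) + (y + z) ≡ (w + y) + (x + z)
  +-interchange = solve 4 (λ w x y z → (w :+ x) :+ (y :+ z) := (w :+ y) :+ (x :+ z)) refl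

*-distribˡ-Σ< : ∀ c n (f : ℕ → ℕ) → c * Σ< n f ≡ Σ< n (λ i → c * f i)
*-distribˡ-Σ< c zero    f = *-zeroʳ c
*-distribˡ-Σ< c (suc n) f =
  trans (*-distribˡ-+ c (Σ< n f) (f n)) (cong (_+ c * f n) (*-distribˡ-Σ< c n f))

Σ<-comm : ∀ m n (f : ℕ → ℕ → ℕ) → Σ< m (λ i → Σ< n (f i)) ≡ Σ< n (λ j → Σ< m (λ i → f i j))
Σ<-comm zero    n f = sym (Σ<-zero n)
Σ<-comm (suc m) n f = trans (cong (_+ Σ< n (f m)) (Σ<-comm m n f))
                            (sym (Σ<-distrib-+ n (λ j → Σ< m (λ i → f i j)) (f m)))

Σ<-head : ∀ n (f : ℕ → ℕ) → Σ< (suc n) f ≡ f 0 + Σ< n (f ∘ suc)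
Σ<-head zero    f = +-comm 0 (f 0)
Σ<-head (suc n) f = trans (cong (_+ f (suc n)) (Σ<-head n f)) (+-assoc (f 0) _ _)

Σ<-reverse : ∀ n (f : ℕ → ℕ) → Σ< n f ≡ Σ< n (λ i → f (n ∸ suc i))
Σ<-reverse zero    f = refl
Σ<-reverse (suc n) f = begin
  Σ< n f + f n                        ≡⟨ cong (_+ f n) (Σ<-reverse n f) ⟩
  Σ< n (λ i → f (n ∸ suc i)) + f n    ≡⟨ +-comm _ (f n) ⟩
  f n + Σ< n (λ i → f (n ∸ suc i))    ≡⟨ Σ<-head n (λ i → f (n ∸ i)) ⟨
  Σ< (suc n) (λ i → f (suc n ∸ suc i)) ∎

Σ<-vanishing-tail : ∀ {m n} (f : ℕ → ℕ) → m ≤ n → (∀ i → m ≤ i → f i ≡ 0) → Σ< n f ≡ Σ< m f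
Σ<-vanishing-tail {m} f m≤n vanish = go (≤⇒≤′ m≤n)
  where
  go : ∀ {n} → m ≤′ n → Σ< n f ≡ Σ< m f
  go ≤′-refl           = refl
  go (≤′-step {n} m≤′n) = begin
    Σ< n f + f n ≡⟨ cong (Σ< n f +_) (vanish n (≤′⇒≤ m≤′n)) ⟩
    Σ< n f + 0   ≡⟨ +-identityʳ (Σ< n f) ⟩
    Σ< n f       ≡⟨ go m≤′n ⟩
    Σ< m f       ∎

sum-applyUpTo : ∀ (f : ℕ → ℕ) n → sum (applyUpTo f n) ≡ Σ< n f
sum-applyUpTo f zero    = refl
sum-applyUpTo f (suc n) = begin
  sum (applyUpTo f (suc n))       ≡⟨ cong sum (applyUpTo-∷ʳ f n) ⟨
  sum (applyUpTo f n ∷ʳ f n)      ≡⟨ sum-++ (applyUpTo f n) (f n ∷ []) ⟩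
  sum (applyUpTo f n) + (f n + 0) ≡⟨ cong₂ _+_ (sum-applyUpTo f n) (+-identityʳ (f n)) ⟩
  Σ< n f + f n                    ∎

sum-map-concatMap : ∀ {A B : Set} (f : B → ℕ) (g : A → List B) xs →
                    sum (map f (concatMap g xs)) ≡ sum (map (λ x → sum (map f (g x))) xs)
sum-map-concatMap f g []       = refl
sum-map-concatMap f g (x ∷ xs) = begin
  sum (map f (g x ++ concatMap g xs))
    ≡⟨ cong sum (map-++ f (g x) (concatMap g xs)) ⟩
  sum (map f (g x) ++ map f (concatMap g xs))
    ≡⟨ sum-++ (map f (g x)) _ ⟩
  sum (map f (g x)) + sum (map f (concatMap g xs))
    ≡⟨ cong (sum (map f (g x)) +_) (sum-map-concatMap f g xs) ⟩
  sum (map f (g x)) + sum (map (λ y → sum (map f (g y))) xs) ∎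

sum-map-*ˡ : ∀ {A : Set} c (f : A → ℕ) xs → sum (map (λ x → c * f x) xs) ≡ c * sum (map f xs)
sum-map-*ˡ c f []       = sym (*-zeroʳ c)
sum-map-*ˡ c f (x ∷ xs) = trans (cong (c * f x +_) (sum-map-*ˡ c f xs)) (sym (*-distribˡ-+ c (f x) _))

sum-compositions-suc : ∀ m n (F : List ℕ → ℕ) →
  sum (map F (compositions (suc m) n)) ≡ Σ< (suc n) (λ w → sum (map (F ∘ (w ∷_)) (compositions m (n ∸ w))))
sum-compositions-suc m n F = begin
  sum (map F (concatMap parts (upTo (suc n))))
    ≡⟨ sum-map-concatMap F parts (upTo (suc n)) ⟩
  sum (map (λ w → sum (map F (parts w))) (upTo (suc n)))
    ≡⟨ cong sum (map-applyUpTo id _ (suc n)) ⟩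
  sum (applyUpTo (λ w → sum (map F (parts w))) (suc n))
    ≡⟨ sum-applyUpTo _ (suc n) ⟩
  Σ< (suc n) (λ w → sum (map F (parts w)))
    ≡⟨ Σ<-cong (suc n) (λ w _ → cong sum (map-∘ (compositions m (n ∸ w)))) ⟨
  Σ< (suc n) (λ w → sum (map (F ∘ (w ∷_)) (compositions m (n ∸ w)))) ∎
  where
  parts : ℕ → List (List ℕ)
  parts w = map (w ∷_) (compositions m (n ∸ w))

compositions-sum : ∀ m n → All (λ ws → sum ws ≡ n) (compositions m n)
compositions-sum zero    zero    = refl ∷ []
compositions-sum zero    (suc n) = []
compositions-sum (suc m) n       = concat⁺ (map⁺ (applyUpTo⁺₁ id (suc n) (λ {w} w<1+n →
  map⁺ (All.map (λ eq → trans (cong (w +_) eq) (m+[n∸m]≡n (s≤s⁻¹ w<1+n))) (compositions-sum m (n ∸ w))))))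

∸-comm : ∀ m n o → m ∸ n ∸ o ≡ m ∸ o ∸ n
∸-comm m n o = begin
  m ∸ n ∸ o   ≡⟨ ∸-+-assoc m n o ⟩
  m ∸ (n + o) ≡⟨ cong (m ∸_) (+-comm n o) ⟩
  m ∸ (o + n) ≡⟨ ∸-+-assoc m o n ⟨
  m ∸ o ∸ n   ∎

C-factorials : ∀ {n k} → k ≤ n → (n C k) * (k ! * (n ∸ k) !) ≡ n !
C-factorials {n} {k} k≤n = trans (cong (_* (k ! * (n ∸ k) !)) (nCk≡n!/k![n-k]! k≤n))
                                 (m/n*n≡m {{k !* (n ∸ k) !≢0}} (k![n∸k]!∣n! k≤n))

C*C-factorials : ∀ n w t → w + t ≤ n →
  (n C w) * ((n ∸ w) C t) * (w ! * (t ! * (n ∸ w ∸ t) !)) ≡ n !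
C*C-factorials n w t w+t≤n = begin
  (n C w) * ((n ∸ w) C t) * (w ! * (t ! * (n ∸ w ∸ t) !))
    ≡⟨ solve 4 (λ c d x y → c :* d :* (x :* y) := c :* (x :* (d :* y))) refl
               (n C w) ((n ∸ w) C t) (w !) (t ! * (n ∸ w ∸ t) !) ⟩
  (n C w) * (w ! * (((n ∸ w) C t) * (t ! * (n ∸ w ∸ t) !)))
    ≡⟨ cong (λ x → (n C w) * (w ! * x)) (C-factorials (m+n≤o⇒m≤o∸n t (subst (_≤ n) (+-comm w t) w+t≤n))) ⟩
  (n C w) * (w ! * (n ∸ w) !)
    ≡⟨ C-factorials (≤-trans (m≤m+n w t) w+t≤n) ⟩
  n ! ∎

C*C-vanishing : ∀ n w t → n < w + t → (n C w) * ((n ∸ w) C t) ≡ 0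
C*C-vanishing n w t n<w+t with w ≤? n
... | no  w≰n = cong (_* ((n ∸ w) C t)) (k>n⇒nCk≡0 (≰⇒> w≰n))
... | yes w≤n = trans (cong ((n C w) *_) (k>n⇒nCk≡0 n∸w<t)) (*-zeroʳ (n C w))
  where
  n∸w<t : n ∸ w < t
  n∸w<t = subst (n ∸ w <_) (m+n∸m≡n w t) (∸-monoˡ-< n<w+t w≤n)

C*C-comm : ∀ n w t → (n C w) * ((n ∸ w) C t) ≡ (n C t) * ((n ∸ t) C w)
C*C-comm n w t with w + t ≤? n
... | no  w+t≰n = trans (C*C-vanishing n w t (≰⇒> w+t≰n))
                        (sym (C*C-vanishing n t w (subst (n <_) (+-comm w t) (≰⇒> w+t≰n))))
... | yes w+t≤n = *-cancelʳ-≡ _ _ (w ! * (t ! * (n ∸ w ∸ t) !)) {{m*n≢0 _ _ {{w !≢0}} {{t !* (n ∸ w ∸ t) !≢0}}}} (begin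
  (n C w) * ((n ∸ w) C t) * (w ! * (t ! * (n ∸ w ∸ t) !))
    ≡⟨ C*C-factorials n w t w+t≤n ⟩
  n !
    ≡⟨ C*C-factorials n t w (subst (_≤ n) (+-comm w t) w+t≤n) ⟨
  (n C t) * ((n ∸ t) C w) * (t ! * (w ! * (n ∸ t ∸ w) !))
    ≡⟨ cong (λ x → (n C t) * ((n ∸ t) C w) * x) (x∙yz≈y∙xz (t !) (w !) ((n ∸ t ∸ w) !)) ⟩
  (n C t) * ((n ∸ t) C w) * (w ! * (t ! * (n ∸ t ∸ w) !))
    ≡⟨ cong (λ m → (n C t) * ((n ∸ t) C w) * (w ! * (t ! * m !))) (∸-comm n t w) ⟩
  (n C t) * ((n ∸ t) C w) * (w ! * (t ! * (n ∸ w ∸ t) !)) ∎)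

factProd-∣ : ∀ ws → factProd ws ∣ sum ws !
factProd-∣ []       = ∣-refl
factProd-∣ (w ∷ ws) = ∣-trans (*-monoʳ-∣ (w !) (factProd-∣ ws))
  (subst (λ m → w ! * m ! ∣ (w + sum ws) !) (m+n∸m≡n w (sum ws)) (k![n∸k]!∣n! (m≤m+n w (sum ws))))

multinomial-*-factProd : ∀ {n} ws → sum ws ≡ n → multinomial n ws * factProd ws ≡ n !
multinomial-*-factProd ws refl = m/n*n≡m {{factProd≢0 ws}} (factProd-∣ ws)

multinomial-∷ : ∀ {n w} ws → w ≤ n → sum ws ≡ n ∸ w →
                multinomial n (w ∷ ws) ≡ (n C w) * multinomial (n ∸ w) ws
multinomial-∷ {n} {w} ws w≤n sum≡n∸w = *-cancelʳ-≡ _ _ (factProd (w ∷ ws)) {{factProd≢0 (w ∷ ws)}} (begin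
  multinomial n (w ∷ ws) * factProd (w ∷ ws)
    ≡⟨ multinomial-*-factProd (w ∷ ws) (trans (cong (w +_) sum≡n∸w) (m+[n∸m]≡n w≤n)) ⟩
  n !
    ≡⟨ C-factorials w≤n ⟨
  (n C w) * (w ! * (n ∸ w) !)
    ≡⟨ cong (λ x → (n C w) * (w ! * x)) (multinomial-*-factProd ws sum≡n∸w) ⟨
  (n C w) * (w ! * (multinomial (n ∸ w) ws * factProd ws))
    ≡⟨ solve 4 (λ c x m f → c :* (x :* (m :* f)) := c :* m :* (x :* f)) refl
               (n C w) (w !) (multinomial (n ∸ w) ws) (factProd ws) ⟩
  (n C w) * multinomial (n ∸ w) ws * (w ! * factProd ws) ∎)

infixl 7 _⋆_

_⋆_ : (ℕ → ℕ) → (ℕ → ℕ) → ℕ → ℕ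
(f ⋆ g) n = Σ< (suc n) (λ w → (n C w) * f w * g (n ∸ w))

⋆-congʳ : ∀ f {g h : ℕ → ℕ} → (∀ m → g m ≡ h m) → ∀ n → (f ⋆ g) n ≡ (f ⋆ h) n
⋆-congʳ f g≗h n = Σ<-cong (suc n) (λ w _ → cong ((n C w) * f w *_) (g≗h (n ∸ w)))

⋆-comm : ∀ f g n → (f ⋆ g) n ≡ (g ⋆ f) n
⋆-comm f g n = trans (Σ<-reverse (suc n) _) (Σ<-cong (suc n) (λ w w<1+n → reflect w (s≤s⁻¹ w<1+n)))
  where
  reflect : ∀ w → w ≤ n → (n C (n ∸ w)) * f (n ∸ w) * g (n ∸ (n ∸ w)) ≡ (n C w) * g w * f (n ∸ w)
  reflect w w≤n = begin
    (n C (n ∸ w)) * f (n ∸ w) * g (n ∸ (n ∸ w))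
      ≡⟨ cong₂ (λ c v → c * f (n ∸ w) * g v) (nCk≡nC[n∸k] w≤n) (sym (m∸[m∸n]≡n w≤n)) ⟨
    (n C w) * f (n ∸ w) * g w
      ≡⟨ xy∙z≈xz∙y (n C w) (f (n ∸ w)) (g w) ⟩
    (n C w) * g w * f (n ∸ w) ∎

⋆-padded : ∀ f g {m} n → m ≤ n → (f ⋆ g) m ≡ Σ< (suc n) (λ w → (m C w) * f w * g (m ∸ w))
⋆-padded f g {m} n m≤n = sym (Σ<-vanishing-tail _ (s≤s m≤n)
  (λ w m<w → cong (λ c → c * f w * g (m ∸ w)) (k>n⇒nCk≡0 m<w)))

⋆-nested : ∀ f g h n → (f ⋆ (g ⋆ h)) n ≡
  Σ< (suc n) (λ w → Σ< (suc n) (λ t → (n C w) * ((n ∸ w) C t) * (f w * g t) * h (n ∸ w ∸ t)))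
⋆-nested f g h n = Σ<-cong (suc n) (λ w _ → begin
  (n C w) * f w * (g ⋆ h) (n ∸ w)
    ≡⟨ cong ((n C w) * f w *_) (⋆-padded g h n (m∸n≤m n w)) ⟩
  (n C w) * f w * Σ< (suc n) (λ t → ((n ∸ w) C t) * g t * h (n ∸ w ∸ t))
    ≡⟨ *-distribˡ-Σ< ((n C w) * f w) (suc n) _ ⟩
  Σ< (suc n) (λ t → (n C w) * f w * (((n ∸ w) C t) * g t * h (n ∸ w ∸ t)))
    ≡⟨ Σ<-cong (suc n) (λ t _ → regroup (n C w) (f w) ((n ∸ w) C t) (g t) (h (n ∸ w ∸ t))) ⟩
  Σ< (suc n) (λ t → (n C w) * ((n ∸ w) C t) * (f w * g t) * h (n ∸ w ∸ t)) ∎)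
  where
  regroup : ∀ c x d y z → c * x * (d * y * z) ≡ c * d * (x * y) * z
  regroup = solve 5 (λ c x d y z → c :* x :* (d :* y :* z) := c :* d :* (x :* y) :* z) refl

⋆-leftComm : ∀ f g h n → (f ⋆ (g ⋆ h)) n ≡ (g ⋆ (f ⋆ h)) n
⋆-leftComm f g h n = begin
  (f ⋆ (g ⋆ h)) n
    ≡⟨ ⋆-nested f g h n ⟩
  Σ< (suc n) (λ w → Σ< (suc n) (λ t → (n C w) * ((n ∸ w) C t) * (f w * g t) * h (n ∸ w ∸ t)))
    ≡⟨ Σ<-comm (suc n) (suc n) _ ⟩
  Σ< (suc n) (λ t → Σ< (suc n) (λ w → (n C w) * ((n ∸ w) C t) * (f w * g t) * h (n ∸ w ∸ t)))
    ≡⟨ Σ<-cong (suc n) (λ t _ → Σ<-cong (suc n) (λ w _ → exchange w t)) ⟩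
  Σ< (suc n) (λ t → Σ< (suc n) (λ w → (n C t) * ((n ∸ t) C w) * (g t * f w) * h (n ∸ t ∸ w)))
    ≡⟨ ⋆-nested g f h n ⟨
  (g ⋆ (f ⋆ h)) n ∎
  where
  exchange : ∀ w t → (n C w) * ((n ∸ w) C t) * (f w * g t) * h (n ∸ w ∸ t)
                   ≡ (n C t) * ((n ∸ t) C w) * (g t * f w) * h (n ∸ t ∸ w)
  exchange w t = cong₂ _*_ (cong₂ _*_ (C*C-comm n w t) (*-comm (f w) (g t))) (cong h (∸-comm n w t))

restricted : ℕ → ℕ → ℕ
restricted k r = sum (map (multinomial r) (compositions k r))

sum-compositions-multinomial : ∀ k n (g : ℕ → ℕ) (F : List ℕ → ℕ) →
  (∀ w ws → F (w ∷ ws) ≡ multinomial n (w ∷ ws) * g w) →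
  sum (map F (compositions (suc k) n)) ≡ (g ⋆ restricted k) n
sum-compositions-multinomial k n g F F-∷ = trans (sum-compositions-suc k n F)
  (Σ<-cong (suc n) (λ w w<1+n → first-section w (s≤s⁻¹ w<1+n)))
  where
  first-section : ∀ w → w ≤ n →
    sum (map (F ∘ (w ∷_)) (compositions k (n ∸ w))) ≡ (n C w) * g w * restricted k (n ∸ w)
  first-section w w≤n = begin
    sum (map (F ∘ (w ∷_)) (compositions k (n ∸ w)))
      ≡⟨ cong sum (map-cong-local (All.map split (compositions-sum k (n ∸ w)))) ⟩
    sum (map (λ ws → (n C w) * g w * multinomial (n ∸ w) ws) (compositions k (n ∸ w)))
      ≡⟨ sum-map-*ˡ ((n C w) * g w) (multinomial (n ∸ w)) (compositions k (n ∸ w)) ⟩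
    (n C w) * g w * restricted k (n ∸ w) ∎
    where
    split : ∀ {ws} → sum ws ≡ n ∸ w → F (w ∷ ws) ≡ (n C w) * g w * multinomial (n ∸ w) ws
    split {ws} sum≡n∸w = begin
      F (w ∷ ws)                                  ≡⟨ F-∷ w ws ⟩
      multinomial n (w ∷ ws) * g w                ≡⟨ cong (_* g w) (multinomial-∷ ws w≤n sum≡n∸w) ⟩
      (n C w) * multinomial (n ∸ w) ws * g w      ≡⟨ xy∙z≈xz∙y (n C w) _ (g w) ⟩
      (n C w) * g w * multinomial (n ∸ w) ws      ∎

p≡a⋆restricted : ∀ k n → p k n ≡ (a ⋆ restricted k) n
p≡a⋆restricted k n = sum-compositions-multinomial k n a (term n) (λ _ _ → refl)

restricted-suc : ∀ k r → restricted (suc k) r ≡ (const 1 ⋆ restricted k) r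
restricted-suc k r =
  sum-compositions-multinomial k r (const 1) (multinomial r) (λ _ _ → sym (*-identityʳ _))

lemma2 : (n k : ℕ) → p (suc k) (suc n) ≡ p k (suc n) + Σ< (suc n) (λ s → (suc n C s) * p k s)
lemma2 n k = begin
  p (suc k) N                                             ≡⟨ p≡a⋆restricted (suc k) N ⟩
  (a ⋆ restricted (suc k)) N                              ≡⟨ ⋆-congʳ a (restricted-suc k) N ⟩
  (a ⋆ (const 1 ⋆ restricted k)) N                        ≡⟨ ⋆-leftComm a (const 1) (restricted k) N ⟩
  (const 1 ⋆ (a ⋆ restricted k)) N                        ≡⟨ ⋆-congʳ (const 1) (p≡a⋆restricted k) N ⟨
  (const 1 ⋆ p k) N                                       ≡⟨ ⋆-comm (const 1) (p k) N ⟩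
  Σ< N (λ s → (N C s) * p k s * 1) + (N C N) * p k N * 1  ≡⟨ +-comm (Σ< N (λ s → (N C s) * p k s * 1)) _ ⟩
  (N C N) * p k N * 1 + Σ< N (λ s → (N C s) * p k s * 1)  ≡⟨ cong₂ _+_ last-term (Σ<-cong N (λ s _ → *-identityʳ _)) ⟩
  p k N + Σ< N (λ s → (N C s) * p k s)                    ∎
  where
  N : ℕ
  N = suc n
  last-term : (N C N) * p k N * 1 ≡ p k N
  last-term = trans (*-identityʳ _) (trans (cong (_* p k N) (nCn≡1 N)) (*-identityˡ (p k N)))
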